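{- Let $\mathcal{O}$ be a uniform oriented matroid of rank $r$ on ground set $E$, let $f\in E$, let $e_2,\dots,e_r\in E$ be such that $\{f,e_2,\dots,e_r\}$ consists of $r$ distinct elements, and let $\alpha_1,\dots,\alpha_r\in\{+,-\}$. Let $\mathcal{O}'=\mathcal{O}[f^{\alpha_1},e_2^{\alpha_2},\dots,e_r^{\alpha_r}]$ be the lexicographic extension. If $M$ is a mutation of $\mathcal{O}$ to which $f$ is not adjacent, then $M$ is also a mutation of $\mathcal{O}'$.
   Context: For independent elements $e_1,\dots,e_k$ of an oriented matroid and signs $\alpha_i$, the lexicographic extension $\mathcal{O}[e_1^{\alpha_1},\dots,e_k^{\alpha_k}]$ is the single-element extension by a new element $p$ in which every cocircuit $X$ of $\mathcal{O}$ extends with $X_p=\alpha_iX_{e_i}$ for the smallest $i$ with $X_{e_i}\neq0$ (and $X_p=0$ if none). A mutation is a simplicial tope $T$ ($[0,T]$ Boolean), equivalently there is a base $B$ whose basic cocircuits are pairwise conformal with composition $T$; the elements of $B$ are adjacent to the mutation. "$M$ is a mutation of $\mathcal{O}'$" means the extension of $T$ (its cocircuits extended to $\mathcal{O}'$) is again a simplicial tope of $\mathcal{O}'$. -}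

module Defs where

open import Data.Nat using (ℕ; zero; suc)
open import Data.Fin using (Fin; zero; suc; toℕ)
open import Data.Fin.Permutation.Components using (transpose)
open import Data.Vec using (Vec; []; _∷_; lookup; tabulate; removeAt)
open import Data.Vec.Membership.Propositional using (_∈_)
open import Data.Maybe using (Maybe; just; nothing)
open import Data.Product using (Σ; ∃; _×_; _,_)
open import Data.Sum using (_⊎_)
open import Relation.Binary.PropositionalEquality using (_≡_; _≢_)
open import Relation.Nullary using (¬_)

data Sign : Set where
  pos neg zer : Sign

opp : Sign → Sign
opp pos = neg
opp neg = pos
opp zer = zer

_·_ : Sign → Sign → Sign
zer · _ = zer
pos · s = s
neg · s = opp s

_∘ₛ_ : Sign → Sign → Sign
zer ∘ₛ s = s
pos ∘ₛ _ = pos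
neg ∘ₛ _ = neg

sgnPow : ℕ → Sign
sgnPow zero    = pos
sgnPow (suc m) = opp (sgnPow m)

swapV : ∀ {E : Set} {r} → Vec E r → Fin r → Fin r → Vec E r
swapV x i j = tabulate (λ m → lookup x (transpose i j m))

-- the m-th Grassmann–Plücker term (tuples written with the distinguished
-- element in front; this changes all terms by the same global sign)
gpTerm : ∀ {E : Set} {k} → (Vec E (suc k) → Sign) →
         Vec E k → Vec E (suc (suc k)) → Fin (suc (suc k)) → Sign
gpTerm χ x y m = sgnPow (toℕ m) · (χ (lookup y m ∷ x) · χ (removeAt y m))

record IsChirotope {E : Set} {k : ℕ} (χ : Vec E (suc k) → Sign) : Set where
  field
    nontrivial : ∃ λ x → χ x ≢ zer
    alt-repeat : ∀ x i j → i ≢ j → lookup x i ≡ lookup x j → χ x ≡ zer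
    alt-swap   : ∀ x i j → i ≢ j → χ (swapV x i j) ≡ opp (χ x)
    grassmannPlucker : ∀ (x : Vec E k) (y : Vec E (suc (suc k))) →
      (∀ m → gpTerm χ x y m ≡ zer) ⊎
      ((∃ λ m → gpTerm χ x y m ≡ pos) × (∃ λ m → gpTerm χ x y m ≡ neg))

Distinct : ∀ {E : Set} {m} → Vec E m → Set
Distinct v = ∀ i j → lookup v i ≡ lookup v j → i ≡ j

IsUniform : ∀ {E : Set} {k} → (Vec E (suc k) → Sign) → Set
IsUniform χ = ∀ x → Distinct x → χ x ≢ zer

IsBase : ∀ {E : Set} {k} → (Vec E (suc k) → Sign) → Vec E (suc k) → Set
IsBase χ B = χ B ≢ zer

-- the cocircuit with zero set ⊇ B \ {B_i}, with the sign choice ε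
basicCocircuit : ∀ {E : Set} {k} → (Vec E (suc k) → Sign) →
                 Vec E (suc k) → Fin (suc k) → Sign → E → Sign
basicCocircuit χ B i ε e = ε · χ (e ∷ removeAt B i)

Conformal : ∀ {E : Set} → (E → Sign) → (E → Sign) → Set
Conformal X Y = ∀ e → (X e · Y e) ≢ neg

composeAll : ∀ {E : Set} {m} → (Fin m → E → Sign) → E → Sign
composeAll {m = zero}  Xs e = zer
composeAll {m = suc m} Xs e = Xs zero e ∘ₛ composeAll (λ i → Xs (suc i)) e

-- T is a simplicial tope (mutation) witnessed by the base B (the elements
-- adjacent to the mutation) and signs ε of the basic cocircuits
IsMutationWith : ∀ {E : Set} {k} → (Vec E (suc k) → Sign) →
                 (E → Sign) → Vec E (suc k) → (Fin (suc k) → Sign) → Set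
IsMutationWith χ T B ε =
  IsBase χ B ×
  (∀ i → ε i ≢ zer) ×
  (∀ i j → Conformal (basicCocircuit χ B i (ε i)) (basicCocircuit χ B j (ε j))) ×
  (∀ e → T e ≡ composeAll (λ i → basicCocircuit χ B i (ε i)) e)

IsMutation : ∀ {E : Set} {k} → (Vec E (suc k) → Sign) → (E → Sign) → Set
IsMutation {E} {k} χ T =
  Σ (Vec E (suc k)) λ B → Σ (Fin (suc k) → Sign) λ ε → IsMutationWith χ T B ε

-- Lexicographic extension  O[e_1^{α_1}, …, e_m^{α_m}]
-- new ground set: Maybe E, with the new element p = nothing

lexSign : ∀ {E : Set} {m} → Vec E m → Vec Sign m → (E → Sign) → Sign
lexSign []       []       X = zer
lexSign (e ∷ es) (a ∷ as) X with X e
... | zer = lexSign es as X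
... | pos = a · pos
... | neg = a · neg

data Split (A : Set) : ℕ → Set where
  none : ∀ {m} → Vec A m → Split A m
  one  : ∀ {m} → Fin (suc m) → Vec A m → Split A (suc m)
  many : ∀ {m} → Split A m

split : ∀ {A : Set} {m} → Vec (Maybe A) m → Split A m
split [] = none []
split (just a ∷ ys) with split ys
... | none z  = none (a ∷ z)
... | one j z = one (suc j) (a ∷ z)
... | many    = many
split (nothing ∷ ys) with split ys
... | none z  = one zero z
... | one _ _ = many
... | many    = many

-- chirotope of the lexicographic extension:
--   χ'(p, z) = σ(X^z) where X^z_e = χ(e, z) is the cocircuit of O given by z,
--   extended by alternation to tuples with p in position j;
--   χ' = χ on tuples avoiding p; χ' = 0 on tuples containing p twice.
lexExt : ∀ {E : Set} {k m} → (Vec E (suc k) → Sign) → Vec E m → Vec Sign m →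
         Vec (Maybe E) (suc k) → Sign
lexExt χ es α y with split y
... | none z  = χ z
... | one j z = sgnPow (toℕ j) · lexSign es α (λ e → χ (e ∷ z))
... | many    = zer

extendCocircuit : ∀ {E : Set} {m} → Vec E m → Vec Sign m → (E → Sign) →
                  Maybe E → Sign
extendCocircuit es α X (just e) = X e
extendCocircuit es α X nothing  = lexSign es α X

extendTope : ∀ {E : Set} {k m} → (Vec E (suc k) → Sign) → Vec E m → Vec Sign m →
             (E → Sign) → Vec E (suc k) → (Fin (suc k) → Sign) → Maybe E → Sign
extendTope χ es α T B ε (just e) = T e
extendTope χ es α T B ε nothing  =
  composeAll (λ i → extendCocircuit es α (basicCocircuit χ B i (ε i))) nothing

-- Since f ∉ B and 𝒪 is uniform, every basic cocircuit X of B has X_f ≠ 0, so its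
-- lexicographic extension is decided by f alone: X_p = α₁ X_f.  The basic cocircuits
-- of B in 𝒪' are exactly these extensions, and two conformal cocircuits stay
-- conformal at p because both are multiplied by the same sign α₁.  Hence B is still
-- a base of 𝒪' with the same sign choices, and it exhibits the extended tope as a
-- simplicial tope of 𝒪'.
module Submission where

open import Defs
open import Data.Nat using (ℕ; suc)
open import Data.Fin using (Fin; zero; suc; punchIn)
open import Data.Fin.Properties using (punchIn-injective; _≟_)
open import Data.Vec using (Vec; []; _∷_; lookup; removeAt; map)
open import Data.Vec.Membership.Propositional using (_∈_)
open import Data.Vec.Membership.Propositional.Properties using (∈-lookup)
open import Data.Vec.Relation.Unary.All using (All)
open import Data.Vec.Relation.Unary.Any using (here; there)
open import Data.Maybe using (just; nothing)
open import Data.Product using (_,_)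
open import Function using (_∘_)
open import Relation.Binary.PropositionalEquality
  using (_≡_; _≢_; refl; sym; trans; cong; cong₂; subst; subst₂; module ≡-Reasoning)
open import Relation.Nullary using (¬_; yes; no; contradiction)

opp-involutive : ∀ s → opp (opp s) ≡ s
opp-involutive pos = refl
opp-involutive neg = refl
opp-involutive zer = refl

·-opp : ∀ s t → s · opp t ≡ opp (s · t)
·-opp pos t = refl
·-opp neg t = refl
·-opp zer t = refl

·-≢zer : ∀ {s t} → s ≢ zer → t ≢ zer → s · t ≢ zer
·-≢zer {pos} {pos} _ _ ()
·-≢zer {pos} {neg} _ _ ()
·-≢zer {neg} {pos} _ _ ()
·-≢zer {neg} {neg} _ _ ()
·-≢zer {zer}       s≢0 _   = contradiction refl s≢0
·-≢zer {pos} {zer} _   t≢0 = contradiction refl t≢0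
·-≢zer {neg} {zer} _   t≢0 = contradiction refl t≢0

opp-·-opp : ∀ s t → opp s · opp t ≡ s · t
opp-·-opp pos t = opp-involutive t
opp-·-opp neg t = refl
opp-·-opp zer t = refl

·-scale-≢neg : ∀ a {s t} → s · t ≢ neg → (a · s) · (a · t) ≢ neg
·-scale-≢neg pos     st≢- = st≢-
·-scale-≢neg zer     _    ()
·-scale-≢neg neg {s} {t} st≢- = st≢- ∘ trans (sym (opp-·-opp s t))

removeAt-punchIn : ∀ {A : Set} {m} (v : Vec A (suc m)) i j →
                   lookup (removeAt v i) j ≡ lookup v (punchIn i j)
removeAt-punchIn (x ∷ xs)     zero    j       = refl
removeAt-punchIn (x ∷ y ∷ xs) (suc i) zero    = refl
removeAt-punchIn (x ∷ y ∷ xs) (suc i) (suc j) = removeAt-punchIn (y ∷ xs) i j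

∈-removeAt⁻ : ∀ {A : Set} {m} {x : A} (v : Vec A (suc m)) i → x ∈ removeAt v i → x ∈ v
∈-removeAt⁻ (y ∷ xs)     zero    x∈       = there x∈
∈-removeAt⁻ (y ∷ z ∷ xs) (suc i) (here p) = here p
∈-removeAt⁻ (y ∷ z ∷ xs) (suc i) (there x∈) = there (∈-removeAt⁻ (z ∷ xs) i x∈)

removeAt-map : ∀ {A B : Set} {m} (g : A → B) (v : Vec A (suc m)) i →
               removeAt (map g v) i ≡ map g (removeAt v i)
removeAt-map g (x ∷ xs)     zero    = refl
removeAt-map g (x ∷ y ∷ xs) (suc i) = cong (g x ∷_) (removeAt-map g (y ∷ xs) i)

Distinct-removeAt : ∀ {A : Set} {m} (v : Vec A (suc m)) i → Distinct v → Distinct (removeAt v i)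
Distinct-removeAt v i v-distinct j j′ eq = punchIn-injective i j j′
  (v-distinct _ _ (trans (sym (removeAt-punchIn v i j)) (trans eq (removeAt-punchIn v i j′))))

Distinct-∷ : ∀ {A : Set} {m} {x : A} {v : Vec A m} → ¬ x ∈ v → Distinct v → Distinct (x ∷ v)
Distinct-∷ x∉v v-distinct zero    zero    _  = refl
Distinct-∷ {v = v} x∉v v-distinct zero (suc j) eq = contradiction (subst (_∈ v) (sym eq) (∈-lookup j v)) x∉v
Distinct-∷ {v = v} x∉v v-distinct (suc i) zero eq = contradiction (subst (_∈ v) eq (∈-lookup i v)) x∉v
Distinct-∷ x∉v v-distinct (suc i) (suc j) eq = cong suc (v-distinct i j eq)

base-distinct : ∀ {E : Set} {k} {χ : Vec E (suc k) → Sign} →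
                IsChirotope χ → ∀ {B} → IsBase χ B → Distinct B
base-distinct isχ {B} B-base i j eq with i ≟ j
... | yes i≡j = i≡j
... | no  i≢j = contradiction (IsChirotope.alt-repeat isχ B i j i≢j eq) B-base

lexSign-zero : ∀ {E : Set} {m} (es : Vec E m) α → lexSign es α (λ _ → zer) ≡ zer
lexSign-zero []       []       = refl
lexSign-zero (e ∷ es) (a ∷ as) = lexSign-zero es as

lexSign-scale : ∀ {E : Set} {m} s (es : Vec E m) α (X : E → Sign) →
                lexSign es α (λ e → s · X e) ≡ s · lexSign es α X
lexSign-scale pos es α X = refl
lexSign-scale zer es α X = lexSign-zero es α
lexSign-scale neg []       []       X = refl
lexSign-scale neg (e ∷ es) (a ∷ as) X with X e
... | zer = lexSign-scale neg es as X
... | pos = ·-opp a pos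
... | neg = ·-opp a neg

lexSign-head : ∀ {E : Set} {m} {f : E} {es : Vec E m} {a as} (X : E → Sign) →
               X f ≢ zer → lexSign (f ∷ es) (a ∷ as) X ≡ a · X f
lexSign-head {f = f} X Xf≢0 with X f
... | zer = contradiction refl Xf≢0
... | pos = refl
... | neg = refl

split-map-just : ∀ {A : Set} {m} (v : Vec A m) → split (map just v) ≡ none v
split-map-just []      = refl
split-map-just (x ∷ v) rewrite split-map-just v = refl

module _ {E : Set} {k m} (χ : Vec E (suc k) → Sign) (es : Vec E m) (α : Vec Sign m) where

  lexExt-map-just : ∀ z → lexExt χ es α (map just z) ≡ χ z
  lexExt-map-just z rewrite split-map-just z = refl

  lexExt-nothing-∷ : ∀ z → lexExt χ es α (nothing ∷ map just z) ≡ lexSign es α (λ e → χ (e ∷ z))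
  lexExt-nothing-∷ z rewrite split-map-just z = refl

  basicCocircuit-lexExt : ∀ B i s x →
    basicCocircuit (lexExt χ es α) (map just B) i s x ≡
    extendCocircuit es α (basicCocircuit χ B i s) x
  basicCocircuit-lexExt B i s (just e) rewrite removeAt-map just B i =
    cong (s ·_) (lexExt-map-just (e ∷ removeAt B i))
  basicCocircuit-lexExt B i s nothing rewrite removeAt-map just B i = begin
    s · lexExt χ es α (nothing ∷ map just (removeAt B i))
      ≡⟨ cong (s ·_) (lexExt-nothing-∷ (removeAt B i)) ⟩
    s · lexSign es α (λ e → χ (e ∷ removeAt B i))
      ≡⟨ sym (lexSign-scale s es α _) ⟩
    lexSign es α (basicCocircuit χ B i s)
      ∎
    where open ≡-Reasoning

extendCocircuit-conformal : ∀ {E : Set} {m} {f : E} {es : Vec E m} {a as} {X Y : E → Sign} →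
  X f ≢ zer → Y f ≢ zer → Conformal X Y →
  Conformal (extendCocircuit (f ∷ es) (a ∷ as) X) (extendCocircuit (f ∷ es) (a ∷ as) Y)
extendCocircuit-conformal _ _ X∼Y (just e) = X∼Y e
extendCocircuit-conformal {f = f} {a = a} {X = X} {Y} Xf≢0 Yf≢0 X∼Y nothing =
  subst₂ (λ s t → s · t ≢ neg) (sym (lexSign-head X Xf≢0)) (sym (lexSign-head Y Yf≢0))
    (·-scale-≢neg a (X∼Y f))

composeAll-cong : ∀ {E E′ : Set} {m} (Xs : Fin m → E → Sign) (Ys : Fin m → E′ → Sign) {e e′} →
  (∀ i → Xs i e ≡ Ys i e′) → composeAll Xs e ≡ composeAll Ys e′
composeAll-cong {m = ℕ.zero} Xs Ys eq = refl
composeAll-cong {m = suc m}  Xs Ys eq =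
  cong₂ _∘ₛ_ (eq zero) (composeAll-cong (Xs ∘ suc) (Ys ∘ suc) (eq ∘ suc))

composeAll-extendCocircuit-just : ∀ {E : Set} {k m} (es : Vec E m) α (Xs : Fin k → E → Sign) e →
  composeAll (λ i → extendCocircuit es α (Xs i)) (just e) ≡ composeAll Xs e
composeAll-extendCocircuit-just es α Xs e = composeAll-cong _ Xs λ i → refl

extendTope-composeAll : ∀ {E : Set} {k m} {χ : Vec E (suc k) → Sign} {es : Vec E m} {α}
  {T B ε} → (∀ e → T e ≡ composeAll (λ i → basicCocircuit χ B i (ε i)) e) →
  ∀ x → extendTope χ es α T B ε x ≡
        composeAll (λ i → extendCocircuit es α (basicCocircuit χ B i (ε i))) x
extendTope-composeAll {χ = χ} {es} {α} {B = B} {ε} T≡ (just e) =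
  trans (T≡ e) (sym (composeAll-extendCocircuit-just es α (λ i → basicCocircuit χ B i (ε i)) e))
extendTope-composeAll T≡ nothing  = refl

mainTheorem19 : ∀ {n k : ℕ} (χ : Vec (Fin n) (suc k) → Sign) →
    IsChirotope χ → IsUniform χ →
    (f : Fin n) (es : Vec (Fin n) k) → Distinct (f ∷ es) →
    (α : Vec Sign (suc k)) → All (λ a → a ≢ zer) α →
    (T : Fin n → Sign) (B : Vec (Fin n) (suc k)) (ε : Fin (suc k) → Sign) →
    IsMutationWith χ T B ε → ¬ (f ∈ B) →
    IsMutation (lexExt χ (f ∷ es) α) (extendTope χ (f ∷ es) α T B ε)
mainTheorem19 χ isχ uniform f es _ α@(a ∷ as) _ T B ε (B-base , ε≢0 , conformal , T≡) f∉B =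
  map just B , ε , B-base′ , ε≢0 , conformal′ , T≡′
  where
  basic≡ : ∀ i s x → basicCocircuit (lexExt χ (f ∷ es) α) (map just B) i s x ≡
                      extendCocircuit (f ∷ es) α (basicCocircuit χ B i s) x
  basic≡ = basicCocircuit-lexExt χ (f ∷ es) α B

  B-base′ : IsBase (lexExt χ (f ∷ es) α) (map just B)
  B-base′ = B-base ∘ trans (sym (lexExt-map-just χ (f ∷ es) α B))

  basic-f≢0 : ∀ i → basicCocircuit χ B i (ε i) f ≢ zer
  basic-f≢0 i = ·-≢zer (ε≢0 i) (uniform _ (Distinct-∷ (f∉B ∘ ∈-removeAt⁻ B i)
                  (Distinct-removeAt B i (base-distinct isχ B-base))))

  conformal′ : ∀ i j → Conformal (basicCocircuit (lexExt χ (f ∷ es) α) (map just B) i (ε i))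
                                 (basicCocircuit (lexExt χ (f ∷ es) α) (map just B) j (ε j))
  conformal′ i j x = subst₂ (λ s t → s · t ≢ neg) (sym (basic≡ i (ε i) x)) (sym (basic≡ j (ε j) x))
    (extendCocircuit-conformal (basic-f≢0 i) (basic-f≢0 j) (conformal i j) x)

  T≡′ : ∀ x → extendTope χ (f ∷ es) α T B ε x ≡
              composeAll (λ i → basicCocircuit (lexExt χ (f ∷ es) α) (map just B) i (ε i)) x
  T≡′ x = trans (extendTope-composeAll T≡ x) (composeAll-cong
    (λ i → extendCocircuit (f ∷ es) α (basicCocircuit χ B i (ε i)))
    (λ i → basicCocircuit (lexExt χ (f ∷ es) α) (map just B) i (ε i))
    λ i → sym (basic≡ i (ε i) x))
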